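{- Let $G=K_{1,\aleph_0}$ be the countable star with centre $v$ and leaves $\{v_i\mid i\in\mathbb{N}\}$, and let $w\in\mathbb{R}_{\geq0}^{V(G)}$ be given by $w(v)=0$ and $w(v_i)=2^{ -i}$ for all $i\in\mathbb{N}$. Then there is no $(w,v)$-optimal sequence.
   Context: A weight distribution on $G$ is $w\in\mathbb{R}_{\geq 0}^{V(G)}$; $w(S)=\sum_{x\in S}w(x)$. For a finite nonempty $T\subseteq V(G)$ inducing a connected subgraph, the sharing move on $T$ replaces $w(x)$ by $w(T)/|T|$ for each $x\in T$ and leaves other values unchanged. $\mathcal{R}(w)$ is the set of weight distributions obtainable from $w$ by a finite sequence of sharing moves, and $w^*(v)=\sup\{w'(v)\mid w'\in\mathcal{R}(w)\}$. A finite sequence $(T_1,\ldots,T_m)$ of sharing moves is $(w,v)$-optimal if the weight distribution $w'$ obtained from $w$ by applying $T_1,\ldots,T_m$ in order satisfies $w'(v)=w^*(v)$. -}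

module Defs where

open import Data.Nat using (ℕ; zero; suc)
import Data.Nat as ℕ
import Data.List.Membership.DecPropositional as DecMem
open import Data.Integer using (+_)
open import Data.Rational using (ℚ; 0ℚ; 1ℚ; _+_; _*_; _/_; _≤_)
open import Data.List using (List; []; _∷_; length; map; foldr; foldl)
open import Data.List.Membership.Propositional using (_∈_)
open import Data.List.Relation.Unary.Unique.Propositional using (Unique)
open import Data.Product using (∃)
open import Data.Bool using (if_then_else_)
open import Relation.Nullary using (Dec; yes; no; ¬_)
open import Relation.Nullary.Decidable using (⌊_⌋)
open import Relation.Binary.PropositionalEquality using (_≡_; refl)

data Vertex : Set where
  centre : Vertex
  leaf   : ℕ → Vertex

data Adj : Vertex → Vertex → Set where
  c-l : ∀ i → Adj centre (leaf i)
  l-c : ∀ i → Adj (leaf i) centre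

_≟V_ : (x y : Vertex) → Dec (x ≡ y)
centre ≟V centre = yes refl
centre ≟V leaf j = no λ ()
leaf i ≟V centre = no λ ()
leaf i ≟V leaf j with i ℕ.≟ j
... | yes refl = yes refl
... | no i≢j = no λ { refl → i≢j refl }

_∈?_ : (x : Vertex) (T : List Vertex) → Dec (x ∈ T)
x ∈? T = DecMem._∈?_ _≟V_ x T

-- Weight distributions (values are rational: all values reachable from
-- the dyadic initial weight by averaging are rational).

Weight : Set
Weight = Vertex → ℚ

wsum : Weight → List Vertex → ℚ
wsum w T = foldr _+_ 0ℚ (map w T)

data WalkIn (T : List Vertex) : Vertex → Vertex → Set where
  here : ∀ {x} → x ∈ T → WalkIn T x x
  step : ∀ {x y z} → x ∈ T → Adj x y → WalkIn T y z → WalkIn T x z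

Connected : List Vertex → Set
Connected T = ∀ {x y} → x ∈ T → y ∈ T → WalkIn T x y

record SharingMove : Set where
  constructor move
  field
    first    : Vertex
    rest     : List Vertex
    distinct : Unique (first ∷ rest)
    conn     : Connected (first ∷ rest)

open SharingMove public

carrier : SharingMove → List Vertex
carrier m = first m ∷ rest m

average : Weight → SharingMove → ℚ
average w m = wsum w (carrier m) * ((+ 1) / suc (length (rest m)))

share : Weight → SharingMove → Weight
share w m x = if ⌊ x ∈? carrier m ⌋ then average w m else w x

applyMoves : Weight → List SharingMove → Weight
applyMoves = foldl share

half^ : ℕ → ℚ
half^ zero    = 1ℚ
half^ (suc i) = ((+ 1) / 2) * half^ i

w₀ : Weight
w₀ centre   = 0ℚ
w₀ (leaf i) = half^ i

-- A sequence is (w,v)-optimal iff the value it produces at v equals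
-- w*(v) = sup{w'(v) | w' ∈ R(w)}.  Since the produced distribution itself
-- lies in R(w), this is the same as: its value at v is an upper bound of
-- the values at v of all reachable distributions.
Optimal : Weight → Vertex → List SharingMove → Set
Optimal w v σ = ∀ (τ : List SharingMove) → applyMoves w τ v ≤ applyMoves w σ v

{-# OPTIONS --safe #-}
-- Given any finite sequence σ, choose a leaf v_N that σ never touches and prepend the
-- move {v, v_N}.  This strictly raises the centre and lowers no vertex except v_N.
-- Sharing moves are monotone (strictly so at a shared vertex that was strictly larger),
-- and σ never reads v_N, so the longer sequence ends strictly higher at the centre than
-- σ does; hence σ was not optimal.
module Submission where

open import Defs
open import Data.List using (List)
open import Relation.Nullary using (¬_)

open import Data.Nat as ℕ using (ℕ; zero; suc)
import Data.Nat.Properties as ℕ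
open import Data.Integer using (+_)
open import Data.Rational using (0ℚ; _/_; _≤_; _<_; Positive; NonNegative)
open import Data.Rational.Properties
open import Data.List using ([]; _∷_; length; map; concatMap)
open import Data.List.Extrema.Nat using (max; xs≤max)
open import Data.List.Membership.Propositional using (_∈_; _∉_)
open import Data.List.Membership.Propositional.Properties using (∈-map⁺; ∈-concatMap⁺)
open import Data.List.Relation.Unary.Any using (here; there)
open import Data.List.Relation.Unary.All as All using (All; []; _∷_)
open import Data.List.Relation.Unary.All.Properties using (¬Any⇒All¬)
open import Data.List.Relation.Unary.AllPairs using ([]; _∷_)
open import Data.Empty using (⊥-elim)
open import Relation.Nullary using (yes; no)
open import Relation.Binary.PropositionalEquality using (_≢_; refl)

1/suc-positive : ∀ n → Positive ((+ 1) / suc n)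
1/suc-positive n = normalize-pos 1 (suc n)

half^-positive : ∀ i → Positive (half^ i)
half^-positive zero = _
half^-positive (suc i) =
  pos*pos⇒pos ((+ 1) / 2) {{1/suc-positive 1}} (half^ i) {{half^-positive i}}

wsum-mono-≤ : ∀ {w w'} T → (∀ {y} → y ∈ T → w y ≤ w' y) → wsum w T ≤ wsum w' T
wsum-mono-≤ []      _    = ≤-refl
wsum-mono-≤ (_ ∷ T) w≤w' =
  +-mono-≤ (w≤w' (here refl)) (wsum-mono-≤ T (λ y∈T → w≤w' (there y∈T)))

wsum-mono-< : ∀ {w w' x} T → (∀ {y} → y ∈ T → w y ≤ w' y) →
              x ∈ T → w x < w' x → wsum w T < wsum w' T
wsum-mono-< (_ ∷ T) w≤w' (here refl) wx<w'x =
  +-mono-<-≤ wx<w'x (wsum-mono-≤ T (λ y∈T → w≤w' (there y∈T)))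
wsum-mono-< (_ ∷ T) w≤w' (there x∈T) wx<w'x =
  +-mono-≤-< (w≤w' (here refl)) (wsum-mono-< T (λ y∈T → w≤w' (there y∈T)) x∈T wx<w'x)

module _ (m : SharingMove) {w w' : Weight} (w≤w' : ∀ {y} → y ∈ carrier m → w y ≤ w' y) where

  private
    1/|T|-positive : Positive ((+ 1) / suc (length (rest m)))
    1/|T|-positive = 1/suc-positive (length (rest m))

    1/|T|-nonNegative : NonNegative ((+ 1) / suc (length (rest m)))
    1/|T|-nonNegative = pos⇒nonNeg ((+ 1) / suc (length (rest m))) {{1/|T|-positive}}

  average-mono-≤ : average w m ≤ average w' m
  average-mono-≤ = *-monoʳ-≤-nonNeg _ {{1/|T|-nonNegative}} (wsum-mono-≤ (carrier m) w≤w')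

  average-mono-< : ∀ {x} → x ∈ carrier m → w x < w' x → average w m < average w' m
  average-mono-< x∈T wx<w'x =
    *-monoˡ-<-pos _ {{1/|T|-positive}} (wsum-mono-< (carrier m) w≤w' x∈T wx<w'x)

  share-mono-≤ : ∀ {x} → w x ≤ w' x → share w m x ≤ share w' m x
  share-mono-≤ {x} wx≤w'x with x ∈? carrier m
  ... | yes _ = average-mono-≤
  ... | no  _ = wx≤w'x

  share-mono-< : ∀ {x} → w x < w' x → share w m x < share w' m x
  share-mono-< {x} wx<w'x with x ∈? carrier m
  ... | yes x∈T = average-mono-< x∈T wx<w'x
  ... | no  _   = wx<w'x

DominatedAwayFrom : Vertex → Weight → Weight → Set
DominatedAwayFrom u w w' = ∀ x → x ≢ u → w x ≤ w' x

Untouched : Vertex → List SharingMove → Set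
Untouched u = All (λ m → u ∉ carrier m)

applyMoves-mono-< : ∀ {u v} σ {w w'} → Untouched u σ → DominatedAwayFrom u w w' →
                    w v < w' v → applyMoves w σ v < applyMoves w' σ v
applyMoves-mono-< []      _             _    wv<w'v = wv<w'v
applyMoves-mono-< (m ∷ σ) {w} {w'} (u∉m ∷ u∉σ) w≤w' wv<w'v =
  applyMoves-mono-< σ u∉σ (λ x x≢u → share-mono-≤ m w≤w'-on-m (w≤w' x x≢u))
                          (share-mono-< m w≤w'-on-m wv<w'v)
  where
  w≤w'-on-m : ∀ {y} → y ∈ carrier m → w y ≤ w' y
  w≤w'-on-m {y} y∈m = w≤w' y (λ { refl → u∉m y∈m })

rank : Vertex → ℕ
rank centre   = 0
rank (leaf i) = i

unusedLeaf : List SharingMove → ℕ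
unusedLeaf σ = suc (max 0 (map rank (concatMap carrier σ)))

unusedLeaf-untouched : ∀ σ → Untouched (leaf (unusedLeaf σ)) σ
unusedLeaf-untouched σ = ¬Any⇒All¬ σ (λ u∈σ → leaf∉touched (∈-concatMap⁺ carrier u∈σ))
  where
  touched : List Vertex
  touched = concatMap carrier σ
  leaf∉touched : leaf (unusedLeaf σ) ∉ touched
  leaf∉touched p = ℕ.1+n≰n (All.lookup (xs≤max 0 (map rank touched)) (∈-map⁺ rank p))

spoke : ℕ → SharingMove
spoke N = move centre (leaf N ∷ []) (((λ ()) ∷ []) ∷ [] ∷ []) connected
  where
  connected : Connected (centre ∷ leaf N ∷ [])
  connected (here refl)         (here refl)         = here (here refl)
  connected (here refl)         (there (here refl)) = step (here refl) (c-l N) (here (there (here refl)))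
  connected (there (here refl)) (here refl)         = step (there (here refl)) (l-c N) (here (here refl))
  connected (there (here refl)) (there (here refl)) = here (there (here refl))

spoke-raises-centre : ∀ N → w₀ centre < share w₀ (spoke N) centre
spoke-raises-centre N = *-monoˡ-<-pos ((+ 1) / 2) {{1/suc-positive 1}}
  (+-mono-≤-< (≤-refl {0ℚ}) (+-mono-<-≤ (positive⁻¹ (half^ N) {{half^-positive N}}) (≤-refl {0ℚ})))

spoke-dominates : ∀ N → DominatedAwayFrom (leaf N) w₀ (share w₀ (spoke N))
spoke-dominates N x x≢leafN with x ∈? carrier (spoke N)
... | yes (here refl)         = <⇒≤ (spoke-raises-centre N)
... | yes (there (here refl)) = ⊥-elim (x≢leafN refl)
... | no  _                   = ≤-refl

proposition4p9 : ∀ (σ : List SharingMove) → ¬ Optimal w₀ centre σ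
proposition4p9 σ optimal = <-irrefl refl (<-≤-trans improved (optimal (spoke N ∷ σ)))
  where
  N = unusedLeaf σ
  improved : applyMoves w₀ σ centre < applyMoves (share w₀ (spoke N)) σ centre
  improved = applyMoves-mono-< σ (unusedLeaf-untouched σ)
                                (spoke-dominates N) (spoke-raises-centre N)
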